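{- Let $\mathbf{A}$ be a finitely subdirectly irreducible positive S4-algebra. Then $\mathbf{A}$ is well-connected, and for every $a\in A\setminus\{0,1\}$ either $\Box a<a$ or $a<\Diamond a$.
   Context: A positive S4-algebra is a structure $\langle A,\land,\lor,\Box,\Diamond,0,1\rangle$ such that $\langle A,\land,\lor,0,1\rangle$ is a bounded distributive lattice, $\Box 1=1$, $\Diamond 0=0$, and for all $a,b$: $\Box(a\land b)=\Box a\land\Box b$, $\Diamond(a\lor b)=\Diamond a\lor\Diamond b$, $\Box a\land\Diamond b\le\Diamond(a\land b)$, $\Box(a\lor b)\le\Box a\lor\Diamond b$, and $\Box\Box a=\Box a\le a\le\Diamond a=\Diamond\Diamond a$. It is well-connected if for all $a,b$: $\Box a\lor\Box b=1$ implies $a=1$ or $b=1$, and $\Diamond a\land\Diamond b=0$ implies $a=0$ or $b=0$. An algebra is finitely subdirectly irreducible if the identity congruence is meet-irreducible in its congruence lattice. -}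

module Defs where

open import Level using (Level; suc; _⊔_)
open import Data.Product using (_×_)
open import Data.Sum using (_⊎_)
open import Relation.Nullary using (¬_)
open import Relation.Binary.Core using (Rel)
open import Relation.Binary.Structures using (IsEquivalence)
open import Relation.Binary.PropositionalEquality using (_≡_)
open import Algebra.Lattice.Structures using (IsDistributiveLattice)

record PositiveS4Algebra (a : Level) : Set (suc a) where
  infixr 7 _∧_
  infixr 6 _∨_
  field
    Carrier : Set a
    _∧_ _∨_ : Carrier → Carrier → Carrier
    □ ◇     : Carrier → Carrier
    𝟘 𝟙     : Carrier
    isDistributiveLattice : IsDistributiveLattice _≡_ _∨_ _∧_
    ∨-identityˡ : ∀ x → 𝟘 ∨ x ≡ x
    ∧-identityˡ : ∀ x → 𝟙 ∧ x ≡ x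
    □-𝟙    : □ 𝟙 ≡ 𝟙
    ◇-𝟘    : ◇ 𝟘 ≡ 𝟘
    □-∧    : ∀ x y → □ (x ∧ y) ≡ □ x ∧ □ y
    ◇-∨    : ∀ x y → ◇ (x ∨ y) ≡ ◇ x ∨ ◇ y
    -- □a ∧ ◇b ≤ ◇(a ∧ b), with  u ≤ v  meaning  u ∧ v ≡ u
    □◇-mix : ∀ x y → (□ x ∧ ◇ y) ∧ ◇ (x ∧ y) ≡ □ x ∧ ◇ y
    -- □(a ∨ b) ≤ □a ∨ ◇b
    ◇□-mix : ∀ x y → □ (x ∨ y) ∧ (□ x ∨ ◇ y) ≡ □ (x ∨ y)
    □-idem : ∀ x → □ (□ x) ≡ □ x
    □-defl : ∀ x → □ x ∧ x ≡ □ x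
    ◇-infl : ∀ x → x ∧ ◇ x ≡ x
    ◇-idem : ∀ x → ◇ (◇ x) ≡ ◇ x

  _≤_ : Carrier → Carrier → Set a
  x ≤ y = x ∧ y ≡ x

  _<_ : Carrier → Carrier → Set a
  x < y = x ≤ y × ¬ (x ≡ y)

module _ {a : Level} (A : PositiveS4Algebra a) where
  open PositiveS4Algebra A

  -- A congruence of A: an equivalence relation compatible with all operations
  -- (compatibility with the constants 0,1 is automatic).
  record IsCongruence (θ : Rel Carrier a) : Set a where
    field
      isEquivalence : IsEquivalence θ
      ∧-cong : ∀ {x y u v} → θ x y → θ u v → θ (x ∧ u) (y ∧ v)
      ∨-cong : ∀ {x y u v} → θ x y → θ u v → θ (x ∨ u) (y ∨ v)
      □-cong : ∀ {x y} → θ x y → θ (□ x) (□ y)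
      ◇-cong : ∀ {x y} → θ x y → θ (◇ x) (◇ y)

  -- θ is (contained in, hence equal to) the identity congruence Δ
  IsIdentity : Rel Carrier a → Set a
  IsIdentity θ = ∀ x y → θ x y → x ≡ y

  -- A is finitely subdirectly irreducible: Δ is meet-irreducible in Con A,
  -- i.e. Δ is not the top element ∇ (A is nontrivial) and
  -- θ ∩ φ = Δ implies θ = Δ or φ = Δ.
  record FinitelySubdirectlyIrreducible : Set (suc a) where
    field
      nontrivial : ¬ ((x y : Carrier) → x ≡ y)
      meet-irreducible : (θ φ : Rel Carrier a) → IsCongruence θ → IsCongruence φ →
        IsIdentity (λ (x y : Carrier) → θ x y × φ x y) → IsIdentity θ ⊎ IsIdentity φ

  WellConnected : Set a
  WellConnected =
    (∀ x y → □ x ∨ □ y ≡ 𝟙 → x ≡ 𝟙 ⊎ y ≡ 𝟙) ×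
    (∀ x y → ◇ x ∧ ◇ y ≡ 𝟘 → x ≡ 𝟘 ⊎ y ≡ 𝟘)

-- For an open element f (□ f ≡ f) the relation  x ∧ f ≡ y ∧ f  is a congruence, and dually
-- x ∨ c ≡ y ∨ c  for a closed c (◇ c ≡ c).  If □ x ∨ □ y ≡ 𝟙, distributivity makes the
-- congruences of the open elements □ x and □ y meet in the identity, so one of them is the
-- identity, which forces □ x ≡ 𝟙 or □ y ≡ 𝟙; the ◇-half is the order dual.  If a is both open
-- and closed, its two congruences meet in the identity by cancellation in distributive
-- lattices, so a ≡ 𝟙 or a ≡ 𝟘; hence every other a has □ a < a or a < ◇ a.
module Submission where

open import Defs
open import Level using (Level)
open import Data.Product using (_×_; _,_)
open import Data.Sum as Sum using (_⊎_; inj₁; inj₂)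
open import Relation.Nullary using (¬_)
open import Relation.Binary.Core using (Rel)
open import Relation.Binary.Structures using (IsEquivalence)
open import Relation.Binary.PropositionalEquality
  using (_≡_; refl; sym; trans; cong; cong₂; subst₂; module ≡-Reasoning)
open import Algebra.Bundles using (CommutativeSemigroup)
open import Algebra.Lattice.Bundles using (DistributiveLattice)
import Algebra.Lattice.Properties.DistributiveLattice as DistributiveLatticeProperties
import Algebra.Properties.CommutativeSemigroup as CommutativeSemigroupProperties

module Properties {a : Level} (A : PositiveS4Algebra a) where
  open PositiveS4Algebra A
  open ≡-Reasoning

  distributiveLattice : DistributiveLattice a a
  distributiveLattice = record { isDistributiveLattice = isDistributiveLattice }

  open DistributiveLattice distributiveLattice public
    using (∧-comm; ∧-assoc; ∨-comm; ∧-absorbs-∨; ∨-absorbs-∧; ∧-distribˡ-∨; ∧-distribʳ-∨)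
  open DistributiveLatticeProperties distributiveLattice public
    using (∧-idem; ∧-isSemigroup; ∧-∨-isDistributiveLattice)

  ∧-commutativeSemigroup : CommutativeSemigroup a a
  ∧-commutativeSemigroup =
    record { isCommutativeSemigroup = record
      { isSemigroup = ∧-isSemigroup ; comm = ∧-comm } }

  open CommutativeSemigroupProperties ∧-commutativeSemigroup using (interchange)

  x∧𝟙≡x : ∀ x → x ∧ 𝟙 ≡ x
  x∧𝟙≡x x = trans (∧-comm x 𝟙) (∧-identityˡ x)

  ∧-distribʳ-∧ : ∀ x y z → (y ∧ z) ∧ x ≡ (y ∧ x) ∧ (z ∧ x)
  ∧-distribʳ-∧ x y z = begin
    (y ∧ z) ∧ x        ≡⟨ cong ((y ∧ z) ∧_) (∧-idem x) ⟨
    (y ∧ z) ∧ (x ∧ x)  ≡⟨ interchange y z x x ⟩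
    (y ∧ x) ∧ (z ∧ x)  ∎

  x≤y⇒y∨x≡y : ∀ {x y} → x ≤ y → y ∨ x ≡ y
  x≤y⇒y∨x≡y {x} {y} x≤y = begin
    y ∨ x        ≡⟨ cong (y ∨_) (trans (sym x≤y) (∧-comm x y)) ⟩
    y ∨ (y ∧ x)  ≡⟨ ∨-absorbs-∧ y x ⟩
    y            ∎

  y∨x≡y⇒x≤y : ∀ {x y} → y ∨ x ≡ y → x ≤ y
  y∨x≡y⇒x≤y {x} {y} y∨x≡y = begin
    x ∧ y        ≡⟨ cong (x ∧_) (trans (sym y∨x≡y) (∨-comm y x)) ⟩
    x ∧ (x ∨ y)  ≡⟨ ∧-absorbs-∨ x y ⟩
    x            ∎

  ≤-antisym : ∀ {x y} → x ≤ y → y ≤ x → x ≡ y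
  ≤-antisym {x} {y} x≤y y≤x = trans (sym x≤y) (trans (∧-comm x y) y≤x)

  ≤-trans : ∀ {x y z} → x ≤ y → y ≤ z → x ≤ z
  ≤-trans {x} {y} {z} x≤y y≤z = begin
    x ∧ z        ≡⟨ cong (_∧ z) x≤y ⟨
    (x ∧ y) ∧ z  ≡⟨ ∧-assoc x y z ⟩
    x ∧ (y ∧ z)  ≡⟨ cong (x ∧_) y≤z ⟩
    x ∧ y        ≡⟨ x≤y ⟩
    x            ∎

  ∧-greatest : ∀ {x y z} → x ≤ y → x ≤ z → x ≤ (y ∧ z)
  ∧-greatest {x} {y} {z} x≤y x≤z =
    trans (sym (∧-assoc x y z)) (trans (cong (_∧ z) x≤y) x≤z)

  x∧y≤y : ∀ x y → (x ∧ y) ≤ y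
  x∧y≤y x y = begin
    (x ∧ y) ∧ y  ≡⟨ ∧-assoc x y y ⟩
    x ∧ (y ∧ y)  ≡⟨ cong (x ∧_) (∧-idem y) ⟩
    x ∧ y        ∎

  x∧y≤x : ∀ x y → (x ∧ y) ≤ x
  x∧y≤x x y = subst₂ _≤_ (∧-comm y x) refl (x∧y≤y y x)

  ◇-mono : ∀ {x y} → x ≤ y → ◇ x ≤ ◇ y
  ◇-mono {x} {y} x≤y = y∨x≡y⇒x≤y (trans (sym (◇-∨ y x)) (cong ◇ (x≤y⇒y∨x≡y x≤y)))

  □x≡𝟙⇒x≡𝟙 : ∀ {x} → □ x ≡ 𝟙 → x ≡ 𝟙
  □x≡𝟙⇒x≡𝟙 {x} □x≡𝟙 = begin
    x        ≡⟨ ∧-identityˡ x ⟨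
    𝟙 ∧ x    ≡⟨ cong (_∧ x) □x≡𝟙 ⟨
    □ x ∧ x  ≡⟨ □-defl x ⟩
    □ x      ≡⟨ □x≡𝟙 ⟩
    𝟙        ∎

  ∧-∨-cancel : ∀ {x y c} → x ∧ c ≡ y ∧ c → x ∨ c ≡ y ∨ c → x ≡ y
  ∧-∨-cancel {x} {y} {c} x∧c≡y∧c x∨c≡y∨c = begin
    x                  ≡⟨ ∧-absorbs-∨ x c ⟨
    x ∧ (x ∨ c)        ≡⟨ cong (x ∧_) x∨c≡y∨c ⟩
    x ∧ (y ∨ c)        ≡⟨ ∧-distribˡ-∨ x y c ⟩
    (x ∧ y) ∨ (x ∧ c)  ≡⟨ cong₂ _∨_ (∧-comm x y) x∧c≡y∧c ⟩
    (y ∧ x) ∨ (y ∧ c)  ≡⟨ ∧-distribˡ-∨ y x c ⟨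
    y ∧ (x ∨ c)        ≡⟨ cong (y ∧_) x∨c≡y∨c ⟩
    y ∧ (y ∨ c)        ≡⟨ ∧-absorbs-∨ y c ⟩
    y                  ∎

  module _ {f : Carrier} (f-open : □ f ≡ f) where

    □-∧-open : ∀ x → □ (x ∧ f) ≡ □ x ∧ f
    □-∧-open x = trans (□-∧ x f) (cong (□ x ∧_) f-open)

    ◇x∧f≤◇[x∧f] : ∀ x → (◇ x ∧ f) ≤ ◇ (x ∧ f)
    ◇x∧f≤◇[x∧f] x = subst₂ _≤_
      (trans (∧-comm (□ f) (◇ x)) (cong (◇ x ∧_) f-open)) (cong ◇ (∧-comm f x)) (□◇-mix f x)

    ◇-∧-open : ∀ x → ◇ x ∧ f ≡ ◇ (x ∧ f) ∧ f
    ◇-∧-open x = ≤-antisym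
      (∧-greatest (◇x∧f≤◇[x∧f] x) (x∧y≤y (◇ x) f))
      (∧-greatest (≤-trans (x∧y≤x (◇ (x ∧ f)) f) (◇-mono (x∧y≤x x f))) (x∧y≤y (◇ (x ∧ f)) f))

dual : {a : Level} → PositiveS4Algebra a → PositiveS4Algebra a
dual A = record
  { Carrier               = Carrier
  ; _∧_                   = _∨_
  ; _∨_                   = _∧_
  ; □                     = ◇
  ; ◇                     = □
  ; 𝟘                     = 𝟙
  ; 𝟙                     = 𝟘
  ; isDistributiveLattice = ∧-∨-isDistributiveLattice
  ; ∨-identityˡ           = ∧-identityˡ
  ; ∧-identityˡ           = ∨-identityˡ
  ; □-𝟙                   = ◇-𝟘
  ; ◇-𝟘                   = □-𝟙
  ; □-∧                   = ◇-∨
  ; ◇-∨                   = □-∧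
  ; □◇-mix                = λ x y → x≤y⇒y∨x≡y
      (subst₂ (λ u v → □ u ≤ v) (∨-comm y x) (∨-comm (□ y) (◇ x)) (◇□-mix y x))
  ; ◇□-mix                = λ x y → x≤y⇒y∨x≡y
      (subst₂ (λ u v → u ≤ ◇ v) (∧-comm (□ y) (◇ x)) (∧-comm y x) (□◇-mix y x))
  ; □-idem                = ◇-idem
  ; □-defl                = λ x → x≤y⇒y∨x≡y (◇-infl x)
  ; ◇-infl                = λ x → x≤y⇒y∨x≡y (□-defl x)
  ; ◇-idem                = □-idem
  }
  where
  open PositiveS4Algebra A
  open Properties A

module Congruences {a : Level} (A : PositiveS4Algebra a) where
  open PositiveS4Algebra A
  open Properties A

  FilterCongruence : Carrier → Rel Carrier a
  FilterCongruence f x y = x ∧ f ≡ y ∧ f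

  filterCongruence-isCongruence : ∀ {f} → □ f ≡ f → IsCongruence A (FilterCongruence f)
  filterCongruence-isCongruence {f} f-open = record
    { isEquivalence = record { refl = refl ; sym = sym ; trans = trans }
    ; ∧-cong = preserved₂ _∧_ (∧-distribʳ-∧ f)
    ; ∨-cong = preserved₂ _∨_ (∧-distribʳ-∨ f)
    ; □-cong = λ {x} {y} p →
        trans (sym (□-∧-open f-open x)) (trans (cong □ p) (□-∧-open f-open y))
    ; ◇-cong = λ {x} {y} p →
        trans (◇-∧-open f-open x) (trans (cong (λ z → ◇ z ∧ f) p) (sym (◇-∧-open f-open y)))
    }
    where
    preserved₂ : (_∙_ : Carrier → Carrier → Carrier) →
      (∀ x u → (x ∙ u) ∧ f ≡ (x ∧ f) ∙ (u ∧ f)) →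
      ∀ {x y u v} → FilterCongruence f x y → FilterCongruence f u v →
      FilterCongruence f (x ∙ u) (y ∙ v)
    preserved₂ _∙_ distrib {x} {y} {u} {v} p q =
      trans (distrib x u) (trans (cong₂ _∙_ p q) (sym (distrib y v)))

  filterCongruence-identity⇒≡𝟙 : ∀ {f} → IsIdentity A (FilterCongruence f) → f ≡ 𝟙
  filterCongruence-identity⇒≡𝟙 {f} identity =
    sym (identity 𝟙 f (trans (∧-identityˡ f) (sym (∧-idem f))))

  filterCongruences-meet-identity : ∀ {f g} → f ∨ g ≡ 𝟙 →
    IsIdentity A (λ x y → FilterCongruence f x y × FilterCongruence g x y)
  filterCongruences-meet-identity {f} {g} f∨g≡𝟙 x y (x∧f≡y∧f , x∧g≡y∧g) = begin
    x                  ≡⟨ x∧𝟙≡x x ⟨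
    x ∧ 𝟙              ≡⟨ cong (x ∧_) f∨g≡𝟙 ⟨
    x ∧ (f ∨ g)        ≡⟨ ∧-distribˡ-∨ x f g ⟩
    (x ∧ f) ∨ (x ∧ g)  ≡⟨ cong₂ _∨_ x∧f≡y∧f x∧g≡y∧g ⟩
    (y ∧ f) ∨ (y ∧ g)  ≡⟨ ∧-distribˡ-∨ y f g ⟨
    y ∧ (f ∨ g)        ≡⟨ cong (y ∧_) f∨g≡𝟙 ⟩
    y ∧ 𝟙              ≡⟨ x∧𝟙≡x y ⟩
    y                  ∎
    where open ≡-Reasoning

  -- Classically this is θ when P holds and the identity otherwise; phrased as a union it lets
  -- meet-irreducibility be applied without deciding P.
  Guarded : Set a → Rel Carrier a → Rel Carrier a
  Guarded P θ x y = x ≡ y ⊎ (P × θ x y)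

  guarded-isCongruence : ∀ {P θ} → (P → IsCongruence A θ) → IsCongruence A (Guarded P θ)
  guarded-isCongruence {P} {θ} congruence = record
    { isEquivalence = record { refl = inj₁ refl ; sym = symmetric ; trans = transitive }
    ; ∧-cong = preserved₂ _∧_ IsCongruence.∧-cong
    ; ∨-cong = preserved₂ _∨_ IsCongruence.∨-cong
    ; □-cong = preserved₁ □ IsCongruence.□-cong
    ; ◇-cong = preserved₁ ◇ IsCongruence.◇-cong
    }
    where
    module θ (p : P) = IsEquivalence (IsCongruence.isEquivalence (congruence p))

    unguard : ∀ {x y} → P → Guarded P θ x y → θ x y
    unguard p (inj₁ refl) = θ.refl p
    unguard p (inj₂ (_ , t)) = t

    symmetric : ∀ {x y} → Guarded P θ x y → Guarded P θ y x
    symmetric (inj₁ x≡y) = inj₁ (sym x≡y)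
    symmetric (inj₂ (p , t)) = inj₂ (p , θ.sym p t)

    transitive : ∀ {x y z} → Guarded P θ x y → Guarded P θ y z → Guarded P θ x z
    transitive (inj₁ refl) s = s
    transitive r (inj₁ refl) = r
    transitive r@(inj₂ (p , _)) s = inj₂ (p , θ.trans p (unguard p r) (unguard p s))

    preserved₁ : (g : Carrier → Carrier) →
      (IsCongruence A θ → ∀ {x y} → θ x y → θ (g x) (g y)) →
      ∀ {x y} → Guarded P θ x y → Guarded P θ (g x) (g y)
    preserved₁ g g-cong (inj₁ x≡y) = inj₁ (cong g x≡y)
    preserved₁ g g-cong (inj₂ (p , t)) = inj₂ (p , g-cong (congruence p) t)

    preserved₂ : (_∙_ : Carrier → Carrier → Carrier) →
      (IsCongruence A θ → ∀ {x y u v} → θ x y → θ u v → θ (x ∙ u) (y ∙ v)) →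
      ∀ {x y u v} → Guarded P θ x y → Guarded P θ u v → Guarded P θ (x ∙ u) (y ∙ v)
    preserved₂ _∙_ ∙-cong (inj₁ refl) (inj₁ refl) = inj₁ refl
    preserved₂ _∙_ ∙-cong r@(inj₂ (p , _)) s =
      inj₂ (p , ∙-cong (congruence p) (unguard p r) (unguard p s))
    preserved₂ _∙_ ∙-cong r s@(inj₂ (p , _)) =
      inj₂ (p , ∙-cong (congruence p) (unguard p r) (unguard p s))

  unguard-identity : ∀ {P θ} → IsIdentity A (Guarded P θ) → P → IsIdentity A θ
  unguard-identity identity p x y t = identity x y (inj₂ (p , t))

module _ {a : Level} {A : PositiveS4Algebra a} where

  isCongruence-undual : ∀ {θ} → IsCongruence (dual A) θ → IsCongruence A θ
  isCongruence-undual c = record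
    { isEquivalence = isEquivalence
    ; ∧-cong = ∨-cong ; ∨-cong = ∧-cong ; □-cong = ◇-cong ; ◇-cong = □-cong
    }
    where open IsCongruence c

  fsi-dual : FinitelySubdirectlyIrreducible A → FinitelySubdirectlyIrreducible (dual A)
  fsi-dual fsi = record
    { nontrivial = nontrivial
    ; meet-irreducible = λ θ φ θ-cong φ-cong →
        meet-irreducible θ φ (isCongruence-undual θ-cong) (isCongruence-undual φ-cong)
    }
    where open FinitelySubdirectlyIrreducible fsi

□-wellConnected : {a : Level} (A : PositiveS4Algebra a) → FinitelySubdirectlyIrreducible A →
  let open PositiveS4Algebra A in ∀ x y → □ x ∨ □ y ≡ 𝟙 → x ≡ 𝟙 ⊎ y ≡ 𝟙
□-wellConnected A fsi x y □x∨□y≡𝟙 = Sum.map □-filter-identity⇒≡𝟙 □-filter-identity⇒≡𝟙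
  (meet-irreducible _ _
    (filterCongruence-isCongruence (□-idem x)) (filterCongruence-isCongruence (□-idem y))
    (filterCongruences-meet-identity □x∨□y≡𝟙))
  where
  open PositiveS4Algebra A
  open Properties A
  open Congruences A
  open FinitelySubdirectlyIrreducible fsi

  □-filter-identity⇒≡𝟙 : ∀ {z} → IsIdentity A (FilterCongruence (□ z)) → z ≡ 𝟙
  □-filter-identity⇒≡𝟙 identity = □x≡𝟙⇒x≡𝟙 (filterCongruence-identity⇒≡𝟙 identity)

wellConnected : {a : Level} (A : PositiveS4Algebra a) → FinitelySubdirectlyIrreducible A →
  WellConnected A
wellConnected A fsi = □-wellConnected A fsi , □-wellConnected (dual A) (fsi-dual fsi)

module _ {a : Level} (A : PositiveS4Algebra a) (fsi : FinitelySubdirectlyIrreducible A) where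
  open PositiveS4Algebra A
  open Properties A
  open Congruences A
  open Congruences (dual A) using () renaming
    ( FilterCongruence               to IdealCongruence
    ; filterCongruence-isCongruence  to idealCongruence-isCongruence
    ; filterCongruence-identity⇒≡𝟙   to idealCongruence-identity⇒≡𝟘
    )
  open FinitelySubdirectlyIrreducible fsi

  □x<x⊎x<◇x : ∀ x → ¬ (x ≡ 𝟘) → ¬ (x ≡ 𝟙) → □ x < x ⊎ x < ◇ x
  □x<x⊎x<◇x x x≢𝟘 x≢𝟙 = Sum.map
    (λ identity → □-defl x , λ □x≡x →
       x≢𝟙 (filterCongruence-identity⇒≡𝟙 (unguard-identity identity □x≡x)))
    (λ identity → ◇-infl x , λ x≡◇x →
       x≢𝟘 (idealCongruence-identity⇒≡𝟘 (unguard-identity identity (sym x≡◇x))))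
    (meet-irreducible
      (Guarded (□ x ≡ x) (FilterCongruence x)) (Guarded (◇ x ≡ x) (IdealCongruence x))
      (guarded-isCongruence filterCongruence-isCongruence)
      (guarded-isCongruence (λ x-closed →
        isCongruence-undual (idealCongruence-isCongruence x-closed)))
      clopen-meet-identity)
    where
    clopen-meet-identity : IsIdentity A (λ u v →
      Guarded (□ x ≡ x) (FilterCongruence x) u v × Guarded (◇ x ≡ x) (IdealCongruence x) u v)
    clopen-meet-identity u v (inj₁ u≡v , _) = u≡v
    clopen-meet-identity u v (_ , inj₁ u≡v) = u≡v
    clopen-meet-identity u v (inj₂ (_ , u∧x≡v∧x) , inj₂ (_ , u∨x≡v∨x)) =
      ∧-∨-cancel u∧x≡v∧x u∨x≡v∨x

corollary4p3 : {ℓ : Level} (A : PositiveS4Algebra ℓ) →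
    FinitelySubdirectlyIrreducible A →
    WellConnected A ×
    (∀ x → ¬ (x ≡ PositiveS4Algebra.𝟘 A) → ¬ (x ≡ PositiveS4Algebra.𝟙 A) →
      PositiveS4Algebra._<_ A (PositiveS4Algebra.□ A x) x ⊎
      PositiveS4Algebra._<_ A x (PositiveS4Algebra.◇ A x))
corollary4p3 A fsi = wellConnected A fsi , □x<x⊎x<◇x A fsi
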